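{- Let $p$ be a prime number and let \[T(p):=\frac{1}{5}\left( (1+\sqrt{5}) \left( \frac{3+\sqrt{5}}{2} \right)^{2p}+(1-\sqrt{5}) \left( \frac{3-\sqrt{5}}{2} \right)^{2p}+3\right),\] which is an integer. Then: (1) if $p \equiv 7 \pmod{65}$, then $T(p)$ is divisible by $131$; (2) if $p \equiv 29 \pmod{35}$, then $T(p)$ is divisible by $71$. -}

module Defs where

open import Data.Nat using (ℕ; zero; suc)
open import Data.Integer using (ℤ; +_)
open import Data.Rational using (ℚ; _/_; 0ℚ; 1ℚ) renaming (_+_ to _+ℚ_; _*_ to _*ℚ_)

record Q5 : Set where
  constructor _+√5·_
  field
    re : ℚ
    ir : ℚ

open Q5 public

infixl 6 _⊕_
infixl 7 _⊗_

_⊕_ : Q5 → Q5 → Q5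
(a +√5· b) ⊕ (c +√5· d) = (a +ℚ c) +√5· (b +ℚ d)

_⊗_ : Q5 → Q5 → Q5
(a +√5· b) ⊗ (c +√5· d) =
  ((a *ℚ c) +ℚ ((+ 5 / 1) *ℚ (b *ℚ d))) +√5· ((a *ℚ d) +ℚ (b *ℚ c))

ι : ℚ → Q5
ι q = q +√5· 0ℚ

one : Q5
one = ι 1ℚ

_^5_ : Q5 → ℕ → Q5
x ^5 zero = one
x ^5 suc n = x ⊗ (x ^5 n)

onePlusSqrt5 onePlusSqrt5' : Q5
onePlusSqrt5  = (+ 1 / 1) +√5· (+ 1 / 1)
onePlusSqrt5' = (+ 1 / 1) +√5· (Data.Rational.- (+ 1 / 1))

α β : Q5
α = (+ 3 / 2) +√5· (+ 1 / 2)
β = (+ 3 / 2) +√5· (Data.Rational.- (+ 1 / 2))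

T : ℕ → Q5
T p = ι (+ 1 / 5) ⊗ ((onePlusSqrt5 ⊗ (α ^5 (2 Data.Nat.* p)))
                      ⊕ (onePlusSqrt5' ⊗ (β ^5 (2 Data.Nat.* p)))
                      ⊕ ι (+ 3 / 1))

-- "x is an integer divisible by m": x = m·k for some integer k
_DividesQ5_ : ℕ → Q5 → Set
m DividesQ5 x = Σ ℤ λ k → x ≡ ι ((+ m / 1) *ℚ (k / 1))
  where
    open import Data.Product using (Σ)
    open import Relation.Binary.PropositionalEquality using (_≡_)

module Submission where

-- Write α = (3+√5)/2 and β = (3−√5)/2.  Their squares α², β² are the roots of
-- t² − 7t + 1, so L n = (1+√5)·α^(2n) + (1−√5)·β^(2n) satisfies
-- L (n+2) = 7·L (n+1) − L n.  Since L 0 = 2 and L 1 = 22, L n is the integer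
-- d n of the sequence 2, 22, 152, … defined by that recurrence, and
-- T n = (d n + 3)/5.  Hence c ∣ T p as soon as 5c ∣ d p + 3.
--
-- A linear recurrence preserves congruences: if d (r + per) ≡ d r and
-- d (r + 1 + per) ≡ d (r + 1) modulo M, then d (q·per + r) ≡ d r for all q.
-- For M = 5·131 = 655, per = 65, r = 7 and for M = 5·71 = 355, per = 35,
-- r = 29 these two congruences and M ∣ d r + 3 are finite computations.

open import Defs
open import Data.Nat as ℕ using (ℕ; zero; suc; NonZero)
import Data.Nat.Properties as ℕP
open import Data.Nat.DivMod using (m≡m%n+[m/n]*n)
open import Data.Nat.Primality using (Prime)
open import Data.Integer as ℤ using (ℤ; +_; -[1+_]; _-_)
import Data.Integer.Properties as ℤP
open import Data.Integer.Divisibility.Signed using (_∣_; divides; _∣?_; ∣m∣n⇒∣m+n; ∣n⇒∣m*n)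
open import Data.Integer.Tactic.RingSolver using (solve-∀)
open import Data.Rational as ℚ using (ℚ; mkℚ; _/_; 0ℚ)
import Data.Rational.Properties as ℚP
open import Data.Rational.Solver using (module +-*-Solver)
open +-*-Solver using (Polynomial; ⟦_⟧; ⟦_⟧↓; prove; con; var; _:+_; _:*_)
open import Data.Nat.Divisibility using (∣1⇒≡1)
open import Data.Vec using (Vec; []; _∷_)
open import Data.Fin using (zero; suc)
open import Data.Product using (_×_; _,_; proj₁; proj₂)
open import Relation.Nullary.Decidable using (True; toWitness)
open import Relation.Binary.PropositionalEquality
open ≡-Reasoning

toℚ : ℤ → ℚ
toℚ i = i / 1

toℚ-normal : ∀ i → toℚ i ≡ mkℚ i 0 (λ {k} k∣i,1 → ∣1⇒≡1 (proj₂ k∣i,1))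
toℚ-normal i = ℚP.↥p/↧p≡p (mkℚ i 0 (λ {k} k∣i,1 → ∣1⇒≡1 (proj₂ k∣i,1)))

toℚ-+ : ∀ i j → toℚ (i ℤ.+ j) ≡ toℚ i ℚ.+ toℚ j
toℚ-+ i j rewrite toℚ-normal i | toℚ-normal j =
  cong (_/ 1) (cong₂ ℤ._+_ (sym (ℤP.*-identityʳ i)) (sym (ℤP.*-identityʳ j)))

toℚ-* : ∀ i j → toℚ (i ℤ.* j) ≡ toℚ i ℚ.* toℚ j
toℚ-* i j rewrite toℚ-normal i | toℚ-normal j = refl

-- The operations mirror _⊕_ and _⊗_ of Defs, so evaluation
-- commutes with them definitionally, and identities in ℚ(√5) reduce to two
-- identities of rational polynomials.
record Term (k : ℕ) : Set where
  constructor _⟨√5⟩_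
  field
    ratPart sqrtPart : Polynomial k
open Term

infixl 6 _⊕ₜ_
infixl 7 _⊗ₜ_

_⊕ₜ_ : ∀ {k} → Term k → Term k → Term k
(a ⟨√5⟩ b) ⊕ₜ (c ⟨√5⟩ d) = (a :+ c) ⟨√5⟩ (b :+ d)

_⊗ₜ_ : ∀ {k} → Term k → Term k → Term k
(a ⟨√5⟩ b) ⊗ₜ (c ⟨√5⟩ d) = (a :* c :+ con (+ 5 / 1) :* (b :* d)) ⟨√5⟩ (a :* d :+ b :* c)

const : ∀ {k} → Q5 → Term k
const (a +√5· b) = con a ⟨√5⟩ con b

⟦_⟧₅ : ∀ {k} → Term k → Vec ℚ k → Q5
⟦ t ⟧₅ ρ = ⟦ ratPart t ⟧ ρ +√5· ⟦ sqrtPart t ⟧ ρ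

solve₅ : ∀ {k} (ρ : Vec ℚ k) (s t : Term k) →
         ⟦ ratPart s ⟧↓ ρ ≡ ⟦ ratPart t ⟧↓ ρ → ⟦ sqrtPart s ⟧↓ ρ ≡ ⟦ sqrtPart t ⟧↓ ρ →
         ⟦ s ⟧₅ ρ ≡ ⟦ t ⟧₅ ρ
solve₅ ρ s t rat≡ sqrt≡ = cong₂ _+√5·_ (prove ρ (ratPart s) (ratPart t) rat≡) (prove ρ (sqrtPart s) (sqrtPart t) sqrt≡)

seven minusOne : Q5
seven    = ι (+ 7 / 1)
minusOne = ι (-[1+ 0 ] / 1)

-- α² and β² are roots of t² − 7t + 1, hence for all x y
-- (1+√5)α⁴x + (1−√5)β⁴y = 7((1+√5)α²x + (1−√5)β²y) − ((1+√5)x + (1−√5)y).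
quartic-relation : ∀ x y →
  onePlusSqrt5 ⊗ (α ⊗ (α ⊗ (α ⊗ (α ⊗ x)))) ⊕ onePlusSqrt5' ⊗ (β ⊗ (β ⊗ (β ⊗ (β ⊗ y))))
  ≡ seven ⊗ (onePlusSqrt5 ⊗ (α ⊗ (α ⊗ x)) ⊕ onePlusSqrt5' ⊗ (β ⊗ (β ⊗ y)))
    ⊕ minusOne ⊗ (onePlusSqrt5 ⊗ x ⊕ onePlusSqrt5' ⊗ y)
quartic-relation x y = solve₅ (re x ∷ ir x ∷ re y ∷ ir y ∷ []) lhs rhs refl refl
  where
  X Y A B : Term 4
  X = var zero ⟨√5⟩ var (suc zero)
  Y = var (suc (suc zero)) ⟨√5⟩ var (suc (suc (suc zero)))
  A = const α
  B = const β
  lhs rhs : Term 4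
  lhs = const onePlusSqrt5 ⊗ₜ (A ⊗ₜ (A ⊗ₜ (A ⊗ₜ (A ⊗ₜ X)))) ⊕ₜ const onePlusSqrt5' ⊗ₜ (B ⊗ₜ (B ⊗ₜ (B ⊗ₜ (B ⊗ₜ Y))))
  rhs = const seven ⊗ₜ (const onePlusSqrt5 ⊗ₜ (A ⊗ₜ (A ⊗ₜ X)) ⊕ₜ const onePlusSqrt5' ⊗ₜ (B ⊗ₜ (B ⊗ₜ Y)))
        ⊕ₜ const minusOne ⊗ₜ (const onePlusSqrt5 ⊗ₜ X ⊕ₜ const onePlusSqrt5' ⊗ₜ Y)

ι-combination : ∀ a b → seven ⊗ ι a ⊕ minusOne ⊗ ι b ≡ ι (toℚ (+ 7) ℚ.* a ℚ.+ toℚ -[1+ 0 ] ℚ.* b)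
ι-combination a b = solve₅ (a ∷ b ∷ []) lhs rhs refl refl
  where
  lhs rhs : Term 2
  lhs = const seven ⊗ₜ (var zero ⟨√5⟩ con 0ℚ) ⊕ₜ const minusOne ⊗ₜ (var (suc zero) ⟨√5⟩ con 0ℚ)
  rhs = (con (toℚ (+ 7)) :* var zero :+ con (toℚ -[1+ 0 ]) :* var (suc zero)) ⟨√5⟩ con 0ℚ

even-power-suc : ∀ x n → x ^5 (2 ℕ.* suc n) ≡ x ⊗ (x ⊗ x ^5 (2 ℕ.* n))
even-power-suc x n = cong (x ^5_) (ℕP.*-suc 2 n)

even-power-suc² : ∀ x n → x ^5 (2 ℕ.* suc (suc n)) ≡ x ⊗ (x ⊗ (x ⊗ (x ⊗ x ^5 (2 ℕ.* n))))
even-power-suc² x n = trans (even-power-suc x (suc n)) (cong (λ z → x ⊗ (x ⊗ z)) (even-power-suc x n))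

L : ℕ → Q5
L n = onePlusSqrt5 ⊗ α ^5 (2 ℕ.* n) ⊕ onePlusSqrt5' ⊗ β ^5 (2 ℕ.* n)

L-recurrence : ∀ n → L (suc (suc n)) ≡ seven ⊗ L (suc n) ⊕ minusOne ⊗ L n
L-recurrence n = begin
  L (suc (suc n))
    ≡⟨ cong₂ combine (even-power-suc² α n) (even-power-suc² β n) ⟩
  combine (α ⊗ (α ⊗ (α ⊗ (α ⊗ u)))) (β ⊗ (β ⊗ (β ⊗ (β ⊗ v))))
    ≡⟨ quartic-relation u v ⟩
  seven ⊗ combine (α ⊗ (α ⊗ u)) (β ⊗ (β ⊗ v)) ⊕ minusOne ⊗ L n
    ≡⟨ cong (λ w → seven ⊗ w ⊕ minusOne ⊗ L n) (sym (cong₂ combine (even-power-suc α n) (even-power-suc β n))) ⟩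
  seven ⊗ L (suc n) ⊕ minusOne ⊗ L n ∎
  where
  u v : Q5
  u = α ^5 (2 ℕ.* n)
  v = β ^5 (2 ℕ.* n)
  combine : Q5 → Q5 → Q5
  combine s t = onePlusSqrt5 ⊗ s ⊕ onePlusSqrt5' ⊗ t

-- The integer sequence d 0 = 2, d 1 = 22, d (n+2) = 7·d (n+1) − d n,
-- computed on consecutive pairs so that concrete terms evaluate quickly.
step : ℤ × ℤ → ℤ × ℤ
step (x , y) = y , + 7 ℤ.* y ℤ.+ -[1+ 0 ] ℤ.* x

consecutive : ℕ → ℤ × ℤ
consecutive zero    = + 2 , + 22
consecutive (suc n) = step (consecutive n)

d : ℕ → ℤ
d n = proj₁ (consecutive n)

L-integral : ∀ n → L n ≡ ι (toℚ (d n))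
L-integral zero          = refl
L-integral (suc zero)    = refl
L-integral (suc (suc n)) = begin
  L (suc (suc n))
    ≡⟨ L-recurrence n ⟩
  seven ⊗ L (suc n) ⊕ minusOne ⊗ L n
    ≡⟨ cong₂ (λ s t → seven ⊗ s ⊕ minusOne ⊗ t) (L-integral (suc n)) (L-integral n) ⟩
  seven ⊗ ι (toℚ (d (suc n))) ⊕ minusOne ⊗ ι (toℚ (d n))
    ≡⟨ ι-combination (toℚ (d (suc n))) (toℚ (d n)) ⟩
  ι (toℚ (+ 7) ℚ.* toℚ (d (suc n)) ℚ.+ toℚ -[1+ 0 ] ℚ.* toℚ (d n))
    ≡⟨ cong ι (sym (trans (toℚ-+ (+ 7 ℤ.* d (suc n)) (-[1+ 0 ] ℤ.* d n))
                          (cong₂ ℚ._+_ (toℚ-* (+ 7) (d (suc n))) (toℚ-* -[1+ 0 ] (d n))))) ⟩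
  ι (toℚ (d (suc (suc n)))) ∎

T-closed : ∀ n → T n ≡ ι ((+ 1 / 5) ℚ.* toℚ (d n ℤ.+ + 3))
T-closed n = begin
  T n                                                 ≡⟨ cong (λ z → ι (+ 1 / 5) ⊗ (z ⊕ ι (+ 3 / 1))) (L-integral n) ⟩
  ι (+ 1 / 5) ⊗ (ι (toℚ (d n)) ⊕ ι (+ 3 / 1))          ≡⟨ solve₅ (toℚ (d n) ∷ []) lhs rhs refl refl ⟩
  ι ((+ 1 / 5) ℚ.* (toℚ (d n) ℚ.+ toℚ (+ 3)))          ≡⟨ cong (λ z → ι ((+ 1 / 5) ℚ.* z)) (sym (toℚ-+ (d n) (+ 3))) ⟩
  ι ((+ 1 / 5) ℚ.* toℚ (d n ℤ.+ + 3))                  ∎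
  where
  lhs rhs : Term 1
  lhs = const (ι (+ 1 / 5)) ⊗ₜ ((var zero ⟨√5⟩ con 0ℚ) ⊕ₜ const (ι (+ 3 / 1)))
  rhs = (con (+ 1 / 5) :* (var zero :+ con (+ 3 / 1))) ⟨√5⟩ con 0ℚ

fifth-of-multiple : ∀ k c → (+ 1 / 5) ℚ.* toℚ (k ℤ.* + (5 ℕ.* c)) ≡ + c / 1 ℚ.* toℚ k
fifth-of-multiple k c = begin
  (+ 1 / 5) ℚ.* toℚ (k ℤ.* + (5 ℕ.* c))          ≡⟨ cong (λ z → (+ 1 / 5) ℚ.* toℚ (k ℤ.* z)) (ℤP.pos-* 5 c) ⟩
  (+ 1 / 5) ℚ.* toℚ (k ℤ.* (+ 5 ℤ.* + c))        ≡⟨ cong ((+ 1 / 5) ℚ.*_) (trans (toℚ-* k _) (cong (toℚ k ℚ.*_) (toℚ-* (+ 5) (+ c)))) ⟩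
  (+ 1 / 5) ℚ.* (toℚ k ℚ.* (toℚ (+ 5) ℚ.* toℚ (+ c)))
    ≡⟨ prove (toℚ k ∷ toℚ (+ c) ∷ [])
         (con (+ 1 / 5) :* (var zero :* (con (+ 5 / 1) :* var (suc zero))))
         (var (suc zero) :* var zero) refl ⟩
  + c / 1 ℚ.* toℚ k ∎

T-divisible : ∀ n c → + (5 ℕ.* c) ∣ d n ℤ.+ + 3 → c DividesQ5 T n
T-divisible n c (divides k d+3≡k·5c) = k , (begin
  T n                                           ≡⟨ T-closed n ⟩
  ι ((+ 1 / 5) ℚ.* toℚ (d n ℤ.+ + 3))            ≡⟨ cong (λ z → ι ((+ 1 / 5) ℚ.* toℚ z)) d+3≡k·5c ⟩
  ι ((+ 1 / 5) ℚ.* toℚ (k ℤ.* + (5 ℕ.* c)))      ≡⟨ cong ι (fifth-of-multiple k c) ⟩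
  ι (+ c / 1 ℚ.* toℚ k)                          ∎)

-- s satisfies the second-order linear recurrence s (n+2) = a·s (n+1) + b·s n
-- (a record rather than a bare Π-type, so that a and b can be inferred).
record LinRec (a b : ℤ) (s : ℕ → ℤ) : Set where
  constructor linRec
  field recurrence : ∀ n → s (suc (suc n)) ≡ a ℤ.* s (suc n) ℤ.+ b ℤ.* s n
open LinRec

d-linRec : LinRec (+ 7) -[1+ 0 ] d
d-linRec = linRec (λ n → refl)

shiftDiff : ℕ → (ℕ → ℤ) → ℕ → ℤ
shiftDiff per s n = s (n ℕ.+ per) - s n

shiftDiff-linRec : ∀ {a b} s per → LinRec a b s → LinRec a b (shiftDiff per s)
shiftDiff-linRec {a} {b} s per rec = linRec λ n → begin
  s (suc (suc n) ℕ.+ per) - s (suc (suc n))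
    ≡⟨ cong₂ _-_ (recurrence rec (n ℕ.+ per)) (recurrence rec n) ⟩
  (a ℤ.* s (suc n ℕ.+ per) ℤ.+ b ℤ.* s (n ℕ.+ per)) - (a ℤ.* s (suc n) ℤ.+ b ℤ.* s n)
    ≡⟨ difference-of-combinations a b (s (suc n ℕ.+ per)) (s (suc n)) (s (n ℕ.+ per)) (s n) ⟩
  a ℤ.* shiftDiff per s (suc n) ℤ.+ b ℤ.* shiftDiff per s n ∎
  where
  difference-of-combinations : ∀ a b x y u v →
    (a ℤ.* x ℤ.+ b ℤ.* u) - (a ℤ.* y ℤ.+ b ℤ.* v) ≡ a ℤ.* (x - y) ℤ.+ b ℤ.* (u - v)
  difference-of-combinations = solve-∀

linRec-∣ : ∀ {a b M} t r → LinRec a b t → M ∣ t r → M ∣ t (suc r) → ∀ k → M ∣ t (k ℕ.+ r)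
linRec-∣ {a} {b} {M} t r rec M∣tr M∣tr+1 k = proj₁ (consecutive-divisible k)
  where
  consecutive-divisible : ∀ k → M ∣ t (k ℕ.+ r) × M ∣ t (suc k ℕ.+ r)
  consecutive-divisible zero    = M∣tr , M∣tr+1
  consecutive-divisible (suc k) with consecutive-divisible k
  ... | M∣tk , M∣tk+1 = M∣tk+1 , subst (M ∣_) (sym (recurrence rec (k ℕ.+ r))) (∣m∣n⇒∣m+n (∣n⇒∣m*n a M∣tk+1) (∣n⇒∣m*n b M∣tk))

linRec-periodic : ∀ {a b M} s per r → LinRec a b s →
                  M ∣ shiftDiff per s r → M ∣ shiftDiff per s (suc r) →
                  ∀ q → M ∣ s (q ℕ.* per ℕ.+ r) - s r
linRec-periodic s per r rec h₀ h₁ zero = divides (+ 0) (ℤP.+-inverseʳ (s r))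
linRec-periodic {M = M} s per r rec h₀ h₁ (suc q) =
  subst (M ∣_) telescope
    (∣m∣n⇒∣m+n (linRec-∣ (shiftDiff per s) r (shiftDiff-linRec s per rec) h₀ h₁ (q ℕ.* per)) (linRec-periodic s per r rec h₀ h₁ q))
  where
  i : ℕ
  i = q ℕ.* per ℕ.+ r
  index : i ℕ.+ per ≡ suc q ℕ.* per ℕ.+ r
  index = begin
    q ℕ.* per ℕ.+ r ℕ.+ per   ≡⟨ ℕP.+-assoc (q ℕ.* per) r per ⟩
    q ℕ.* per ℕ.+ (r ℕ.+ per) ≡⟨ cong (q ℕ.* per ℕ.+_) (ℕP.+-comm r per) ⟩
    q ℕ.* per ℕ.+ (per ℕ.+ r) ≡⟨ sym (ℕP.+-assoc (q ℕ.* per) per r) ⟩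
    q ℕ.* per ℕ.+ per ℕ.+ r   ≡⟨ cong (ℕ._+ r) (ℕP.+-comm (q ℕ.* per) per) ⟩
    suc q ℕ.* per ℕ.+ r       ∎
  telescoping : ∀ x y z → (x - y) ℤ.+ (y - z) ≡ x - z
  telescoping = solve-∀
  telescope : shiftDiff per s i ℤ.+ (s i - s r) ≡ s (suc q ℕ.* per ℕ.+ r) - s r
  telescope = trans (telescoping (s (i ℕ.+ per)) (s i) (s r)) (cong (λ j → s j - s r) index)

criterion : ∀ c r per .{{_ : NonZero per}} p → p ℕ.% per ≡ r →
            + (5 ℕ.* c) ∣ shiftDiff per d r → + (5 ℕ.* c) ∣ shiftDiff per d (suc r) →
            + (5 ℕ.* c) ∣ d r ℤ.+ + 3 → c DividesQ5 T p
criterion c r per p p%per≡r h₀ h₁ 5c∣dr+3 =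
  T-divisible p c (subst (λ j → + (5 ℕ.* c) ∣ d j ℤ.+ + 3) (sym p≡q·per+r)
    (subst (+ (5 ℕ.* c) ∣_) (shift-constant (d (q ℕ.* per ℕ.+ r)) (d r) (+ 3))
      (∣m∣n⇒∣m+n (linRec-periodic d per r d-linRec h₀ h₁ q) 5c∣dr+3)))
  where
  q : ℕ
  q = p ℕ./ per
  p≡q·per+r : p ≡ q ℕ.* per ℕ.+ r
  p≡q·per+r = trans (m≡m%n+[m/n]*n p per) (trans (ℕP.+-comm (p ℕ.% per) _) (cong (q ℕ.* per ℕ.+_) p%per≡r))
  shift-constant : ∀ x y z → (x - y) ℤ.+ (y ℤ.+ z) ≡ x ℤ.+ z
  shift-constant = solve-∀

by-evaluation : ∀ {m n} {_ : True (m ∣? n)} → m ∣ n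
by-evaluation {_} {_} {m∣?n} = toWitness m∣?n

theorem3 : (p : ℕ) → Prime p → ((p ℕ.% 65 ≡ 7 → 131 DividesQ5 T p) × (p ℕ.% 35 ≡ 29 → 71 DividesQ5 T p))
theorem3 p _ =
  (λ p≡7  → criterion 131 7  65 p p≡7  by-evaluation by-evaluation by-evaluation) ,
  (λ p≡29 → criterion 71  29 35 p p≡29 by-evaluation by-evaluation by-evaluation)
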